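{- Let $G$ be a clean, connected graph with no induced $P_7$ and no triangle. Then for every induced $7$-cycle $C$ in $G$: (1) $Z^C$ is empty; and (2) every connected component of $G[Y^C]$ has one or two vertices.
   Context: For an induced $7$-cycle $C$ given by $v_0-\dots-v_6-v_0$ (indices mod $7$): $P^C$ is the set of vertices $v\notin V(C)$ with $N(v)\cap V(C)=\{v_i,v_{i+3}\}$ for some $i$; $S^C$ is the set of $v\notin V(C)$ with $N(v)\cap V(C)=\{v_{i-2},v_i,v_{i+2}\}$ for some $i$; $A^C$ is the set of vertices not in $V(C)$ with no neighbor in $V(C)$; $X^C$ is the set of vertices in $A^C$ with a neighbor in $P^C$; $Y^C$ is the set of vertices in $A^C\setminus X^C$ with a neighbor in $S^C$; $Z^C=A^C\setminus(X^C\cup Y^C)$. A vertex $u$ is dominated by $v\neq u$ if $u,v$ are non-adjacent and $N(u)\subseteq N(v)$. A non-trivial homogeneous pair of stable sets is a pair $(A,B)$ of disjoint non-empty stable sets with $2<|A|+|B|<|V(G)|$ such that no vertex outside $A\cup B$ has both a neighbor and a non-neighbor in $A$, or in $B$. $G$ is clean if it has no dominated vertex and no non-trivial homogeneous pair of stable sets. -}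

module Defs where

open import Data.Nat using (ℕ; suc; _+_; _<_)
open import Data.Nat.DivMod using (_mod_)
open import Data.Fin using (Fin; toℕ)
open import Data.Fin.Subset using (Subset; _∈_; _∉_; ∣_∣)
open import Data.Product using (Σ; _×_; _,_; ∃)
open import Data.Sum using (_⊎_)
open import Data.Empty using (⊥)
open import Data.Unit using (⊤)
open import Relation.Nullary using (¬_)
open import Relation.Binary using (Decidable)
open import Relation.Binary.PropositionalEquality using (_≡_; _≢_)

record Graph : Set₁ where
  field
    n     : ℕ
    E     : Fin n → Fin n → Set
    E-sym : ∀ {u v} → E u v → E v u
    E-irr : ∀ {u} → ¬ E u u
    E-dec : Decidable E

module _ (G : Graph) where
  open Graph G

  V : Set
  V = Fin n

  data ReachIn (P : V → Set) : V → V → Set where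
    here : ∀ {u} → P u → ReachIn P u u
    step : ∀ {u v w} → P u → E u v → ReachIn P v w → ReachIn P u w

  Connected : Set
  Connected = ∀ u v → ReachIn (λ _ → ⊤) u v

  TriangleFree : Set
  TriangleFree = ∀ a b c → E a b → E b c → E a c → ⊥

  Consec : Fin 7 → Fin 7 → Set
  Consec i j = suc (toℕ i) ≡ toℕ j ⊎ suc (toℕ j) ≡ toℕ i

  InducedP7 : (Fin 7 → V) → Set
  InducedP7 f = (∀ i j → f i ≡ f j → i ≡ j)
              × (∀ i j → (E (f i) (f j) → Consec i j) × (Consec i j → E (f i) (f j)))

  P7Free : Set
  P7Free = ∀ f → ¬ InducedP7 f

  _⊕_ : Fin 7 → ℕ → Fin 7
  i ⊕ k = (toℕ i + k) mod 7

  InducedC7 : (Fin 7 → V) → Set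
  InducedC7 c = (∀ i j → c i ≡ c j → i ≡ j)
              × (∀ i j → (E (c i) (c j) → (j ≡ i ⊕ 1 ⊎ i ≡ j ⊕ 1))
                        × ((j ≡ i ⊕ 1 ⊎ i ≡ j ⊕ 1) → E (c i) (c j)))

  DominatedBy : V → V → Set
  DominatedBy u v = u ≢ v × ¬ E u v × (∀ w → E u w → E v w)

  Stable : Subset n → Set
  Stable A = ∀ a b → a ∈ A → b ∈ A → ¬ E a b

  NotMixedOn : Subset n → V → Set
  NotMixedOn A v = ¬ ((∃ λ a → a ∈ A × E v a) × (∃ λ a → a ∈ A × ¬ E v a))

  NonTrivialHomPairStable : Subset n → Subset n → Set
  NonTrivialHomPairStable A B =
      (∀ v → v ∈ A → v ∉ B)
    × (∃ λ a → a ∈ A) × (∃ λ b → b ∈ B)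
    × Stable A × Stable B
    × 2 < ∣ A ∣ + ∣ B ∣ × ∣ A ∣ + ∣ B ∣ < n
    × (∀ v → v ∉ A → v ∉ B → NotMixedOn A v × NotMixedOn B v)

  Clean : Set
  Clean = (∀ u v → ¬ DominatedBy u v)
        × (∀ A B → ¬ NonTrivialHomPairStable A B)

  module _ (c : Fin 7 → V) where

    OffC : V → Set
    OffC v = ∀ j → v ≢ c j

    InP : V → Set
    InP v = OffC v × (∃ λ i → ∀ j → (E v (c j) → (j ≡ i ⊎ j ≡ i ⊕ 3))
                                   × ((j ≡ i ⊎ j ≡ i ⊕ 3) → E v (c j)))

    -- v ∈ S^C   (neighbours v_{i-2}, v_i, v_{i+2};  i-2 = i+5 mod 7)
    InS : V → Set
    InS v = OffC v × (∃ λ i → ∀ j → (E v (c j) → (j ≡ i ⊕ 5 ⊎ j ≡ i ⊎ j ≡ i ⊕ 2))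
                                   × ((j ≡ i ⊕ 5 ⊎ j ≡ i ⊎ j ≡ i ⊕ 2) → E v (c j)))

    InA : V → Set
    InA v = OffC v × (∀ j → ¬ E v (c j))

    InX : V → Set
    InX v = InA v × (∃ λ p → InP p × E v p)

    InY : V → Set
    InY v = InA v × ¬ InX v × (∃ λ s → InS s × E v s)

    InZ : V → Set
    InZ v = InA v × ¬ InX v × ¬ InY v

module Submission where

-- (1) A neighbour of a vertex of A that has a neighbour on C lies in P ∪ S: any other trace on C
-- closes a triangle or leaves four consecutive cycle vertices unseen, giving an induced P₇ along C.
-- So every neighbour t of z ∈ Z lies in A. Moreover t ∉ X, since z - t - p followed by four vertices
-- of C would be an induced P₇, and t ∉ Y, since otherwise z is dominated by the S-neighbour s of t
-- (a neighbour of z missing s again yields an induced P₇ ending at s). Thus Z is closed under taking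
-- neighbours; it avoids C, so by connectivity Z is empty.
-- (2) For every v ∉ Y, adjacency to v propagates along paths y₁ - y₂ - y₃ inside Y: otherwise v lies
-- in S (and y₃ - y₂ - y₁ - v extends to an induced P₇), in X (likewise) or in Z = ∅. Hence in a
-- component K of G[Y] through u, the S-neighbour of u sees exactly the vertices at even distance from
-- u, so K is bipartite with sides A, B; these are stable and no outside vertex is mixed on either.
-- If |K| ≥ 3, (A , B) is a non-trivial homogeneous pair of stable sets, contradicting cleanness.


open import Defs
open import Data.Fin using (Fin)
open import Data.Sum using (_⊎_)
open import Data.Product using (_×_)
open import Relation.Nullary using (¬_)
open import Relation.Binary.PropositionalEquality using (_≡_)

open import Data.Bool.Properties using (T-≡)
open import Data.Empty using (⊥; ⊥-elim)
open import Data.Fin as Fin using (zero; suc; toℕ)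
open import Data.Fin.Properties using (all?; any?; toℕ-injective; toℕ-fromℕ<; toℕ<n)
open import Data.Fin.Subset using (Subset; inside; outside; _∈_; _∉_; _⊆_; _∪_; ⁅_⁆; ∣_∣; Empty)
open import Data.Fin.Subset.Properties
  using ( _∈?_; nonempty?; drop-∷-⊆; p⊆q⇒∣p∣≤∣q∣; p⊂q⇒∣p∣<∣q∣; ∣p∣≤n; ∣⊤∣≡n; ⊆⊤; ∈⊤
        ; p⊆p∪q; q⊆p∪q; x∈p∪q⁻; x∈p∪q⁺; x∈⁅x⁆; x∈⁅y⁆⇒x≡y; x∈p⇒∣p-x∣<∣p∣; x∈p∧x≢y⇒x∈p-y)
open import Data.Nat as ℕ using (ℕ; zero; suc; _+_; _∸_; _≤_; _<_; z≤n; s≤s; NonZero)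
open import Data.Nat.DivMod using (_%_; _mod_; %-distribˡ-+; m%n%n≡m%n; [m+n]%n≡m%n; m<n⇒m%n≡m)
open import Data.Nat.Properties
  using (≤-trans; <-irrefl; <⇒≤; +-suc; +-comm; +-assoc; +-identityʳ; +-monoʳ-≤; m≤m+n; m∸n+n≡m; suc-injective)
open import Data.Product as Product using (∃; _,_; proj₁; proj₂)
open import Data.Sum using (inj₁; inj₂; [_,_]′)
open import Data.Unit using (⊤; tt)
open import Data.Vec using (Vec; []; _∷_; lookup; tabulate; here; there)
open import Data.Vec.Properties using (lookup∘tabulate; []=⇒lookup; lookup⇒[]=)
open import Data.Vec.Relation.Unary.All using (All; []; _∷_)
open import Data.Vec.Relation.Unary.All.Properties using (lookup⁺)
open import Function using (_∘_; id; Equivalence)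
open import Relation.Binary using (Decidable)
open import Relation.Nullary using (Dec; yes; no; ¬?; contradiction)
open import Relation.Nullary.Decidable
  using (isYes; False; decidable-stable; toWitness; toWitnessFalse; fromWitness; map′; _×-dec_; _⊎-dec_; _→-dec_)
open import Relation.Binary.Construct.Closure.ReflexiveTransitive using (Star; ε; _◅_; _◅◅_; reverse)
open import Relation.Binary.PropositionalEquality using (_≢_; refl; sym; trans; cong; subst; module ≡-Reasoning)
open ≡-Reasoning

-- Subsets of Fin n

module _ {n} {P : Fin n → Set} (P? : ∀ x → Dec (P x)) where

  subsetOf : Subset n
  subsetOf = tabulate (λ x → isYes (P? x))

  ∈-subsetOf⁺ : ∀ {x} → P x → x ∈ subsetOf
  ∈-subsetOf⁺ {x} px = lookup⇒[]= x subsetOf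
    (trans (lookup∘tabulate _ x) (Equivalence.to T-≡ (fromWitness {a? = P? x} px)))

  ∈-subsetOf⁻ : ∀ {x} → x ∈ subsetOf → P x
  ∈-subsetOf⁻ {x} x∈ = toWitness {a? = P? x}
    (Equivalence.from T-≡ (trans (sym (lookup∘tabulate _ x)) ([]=⇒lookup x∈)))

all-subsets? : ∀ {n} {P : Subset n → Set} → (∀ p → Dec (P p)) → Dec (∀ p → P p)
all-subsets? {zero}  P? = map′ (λ { P[] [] → P[] }) (λ ∀P → ∀P []) (P? [])
all-subsets? {suc n} P? = map′
  (λ { (Pin , Pout) (inside ∷ p) → Pin p ; (Pin , Pout) (outside ∷ p) → Pout p })
  (λ ∀P → ∀P ∘ (inside ∷_) , ∀P ∘ (outside ∷_))
  (all-subsets? (P? ∘ (inside ∷_)) ×-dec all-subsets? (P? ∘ (outside ∷_)))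

⊆⇒≡⊎∣∣< : ∀ {n} {p q : Subset n} → p ⊆ q → p ≡ q ⊎ ∣ p ∣ < ∣ q ∣
⊆⇒≡⊎∣∣< {p = []}          {[]}          _   = inj₁ refl
⊆⇒≡⊎∣∣< {p = outside ∷ p} {outside ∷ q} p⊆q = Data.Sum.map (cong (outside ∷_)) id (⊆⇒≡⊎∣∣< (drop-∷-⊆ p⊆q))
⊆⇒≡⊎∣∣< {p = outside ∷ p} {inside  ∷ q} p⊆q = inj₂ (s≤s (p⊆q⇒∣p∣≤∣q∣ (drop-∷-⊆ p⊆q)))
⊆⇒≡⊎∣∣< {p = inside  ∷ p} {outside ∷ q} p⊆q = contradiction (p⊆q here) λ ()
⊆⇒≡⊎∣∣< {p = inside  ∷ p} {inside  ∷ q} p⊆q = Data.Sum.map (cong (inside ∷_)) s≤s (⊆⇒≡⊎∣∣< (drop-∷-⊆ p⊆q))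

-- Each step that is not stationary increases ∣ p ∣ ≤ n, so n steps of fuel suffice.
module _ {n} (f : Subset n → Subset n) (inflationary : ∀ p → p ⊆ f p)
             (Inv : Subset n → Set) (preserved : ∀ p → Inv p → Inv (f p)) where

  fixpoint-with-fuel : ∀ k p → n ≤ k + ∣ p ∣ → Inv p → ∃ λ q → f q ≡ q × Inv q
  fixpoint-with-fuel k p bound inv with ⊆⇒≡⊎∣∣< (inflationary p)
  ... | inj₁ p≡fp = p , sym p≡fp , inv
  fixpoint-with-fuel zero p bound inv | inj₂ grows =
    ⊥-elim (<-irrefl refl (≤-trans grows (≤-trans (∣p∣≤n (f p)) bound)))
  fixpoint-with-fuel (suc k) p bound inv | inj₂ grows =
    fixpoint-with-fuel k (f p) (≤-trans bound (subst (_≤ k + ∣ f p ∣) (+-suc k ∣ p ∣) (+-monoʳ-≤ k grows)))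
      (preserved p inv)

  fixpoint : ∀ p → Inv p → ∃ λ q → f q ≡ q × Inv q
  fixpoint p = fixpoint-with-fuel n p (m≤m+n n ∣ p ∣)

drop-∷-disjoint : ∀ {n s t} {p q : Subset n} →
  (∀ {x} → x ∈ s ∷ p → x ∉ t ∷ q) → ∀ {x} → x ∈ p → x ∉ q
drop-∷-disjoint disj x∈p x∈q = disj (there x∈p) (there x∈q)

disjoint⇒∣p∪q∣≡∣p∣+∣q∣ : ∀ {n} (p q : Subset n) → (∀ {x} → x ∈ p → x ∉ q) → ∣ p ∪ q ∣ ≡ ∣ p ∣ + ∣ q ∣
disjoint⇒∣p∪q∣≡∣p∣+∣q∣ []            []            _    = refl
disjoint⇒∣p∪q∣≡∣p∣+∣q∣ (inside ∷ p)  (inside ∷ q)  disj = ⊥-elim (disj here here)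
disjoint⇒∣p∪q∣≡∣p∣+∣q∣ (inside ∷ p)  (outside ∷ q) disj =
  cong suc (disjoint⇒∣p∪q∣≡∣p∣+∣q∣ p q (drop-∷-disjoint disj))
disjoint⇒∣p∪q∣≡∣p∣+∣q∣ (outside ∷ p) (inside ∷ q)  disj =
  trans (cong suc (disjoint⇒∣p∪q∣≡∣p∣+∣q∣ p q (drop-∷-disjoint disj))) (sym (+-suc ∣ p ∣ ∣ q ∣))
disjoint⇒∣p∪q∣≡∣p∣+∣q∣ (outside ∷ p) (outside ∷ q) disj =
  disjoint⇒∣p∪q∣≡∣p∣+∣q∣ p q (drop-∷-disjoint disj)

three-elements⇒2<∣p∣ : ∀ {n} {p : Subset n} {x y z} → x ∈ p → y ∈ p → z ∈ p →
  y ≢ x → z ≢ x → z ≢ y → 2 < ∣ p ∣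
three-elements⇒2<∣p∣ x∈p y∈p z∈p y≢x z≢x z≢y =
  ≤-trans (s≤s (≤-trans (s≤s (≤-trans (s≤s z≤n) (x∈p⇒∣p-x∣<∣p∣ z∈p-x-y)))
                        (x∈p⇒∣p-x∣<∣p∣ y∈p-x)))
          (x∈p⇒∣p-x∣<∣p∣ x∈p)
  where
  y∈p-x = x∈p∧x≢y⇒x∈p-y y∈p y≢x
  z∈p-x-y = x∈p∧x≢y⇒x∈p-y (x∈p∧x≢y⇒x∈p-y z∈p z≢x) z≢y

x∉p⇒∣p∣<n : ∀ {n} {p : Subset n} {x} → x ∉ p → ∣ p ∣ < n
x∉p⇒∣p∣<n {n} {p} {x} x∉p = subst (∣ p ∣ <_) (∣⊤∣≡n n) (p⊂q⇒∣p∣<∣q∣ (⊆⊤ , x , ∈⊤ , x∉p))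

-- Arithmetic modulo n

module _ {n : ℕ} .{{_ : NonZero n}} where

  [m%n+k]%n≡[m+k]%n : ∀ m k → (m % n + k) % n ≡ (m + k) % n
  [m%n+k]%n≡[m+k]%n m k = begin
    (m % n + k) % n         ≡⟨ %-distribˡ-+ (m % n) k n ⟩
    (m % n % n + k % n) % n ≡⟨ cong (λ x → (x + k % n) % n) (m%n%n≡m%n m n) ⟩
    (m % n + k % n) % n     ≡⟨ %-distribˡ-+ m k n ⟨
    (m + k) % n             ∎

  [k+m%n]%n≡[k+m]%n : ∀ k m → (k + m % n) % n ≡ (k + m) % n
  [k+m%n]%n≡[k+m]%n k m = begin
    (k + m % n) % n ≡⟨ cong (_% n) (+-comm k (m % n)) ⟩
    (m % n + k) % n ≡⟨ [m%n+k]%n≡[m+k]%n m k ⟩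
    (m + k) % n     ≡⟨ cong (_% n) (+-comm m k) ⟩
    (k + m) % n     ∎

  -- Adding n ∸ x undoes the shift by x.
  +-cancelˡ-% : ∀ x a b → x ≤ n → (x + a) % n ≡ (x + b) % n → a % n ≡ b % n
  +-cancelˡ-% x a b x≤n eq = trans (unshift a) (trans (cong (λ y → (n ∸ x + y) % n) eq) (sym (unshift b)))
    where
    unshift : ∀ m → m % n ≡ (n ∸ x + (x + m) % n) % n
    unshift m = begin
      m % n                     ≡⟨ [m+n]%n≡m%n m n ⟨
      (m + n) % n               ≡⟨ cong (_% n) (+-comm m n) ⟩
      (n + m) % n               ≡⟨ cong (λ y → (y + m) % n) (m∸n+n≡m x≤n) ⟨
      (n ∸ x + x + m) % n       ≡⟨ cong (_% n) (+-assoc (n ∸ x) x m) ⟩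
      (n ∸ x + (x + m)) % n     ≡⟨ [k+m%n]%n≡[k+m]%n (n ∸ x) (x + m) ⟨
      (n ∸ x + (x + m) % n) % n ∎

-- Defs' _⊕_ G, which does not depend on G; the two agree definitionally.
_+₇_ : Fin 7 → ℕ → Fin 7
i +₇ k = (toℕ i + k) mod 7

toℕ-+₇ : ∀ i k → toℕ (i +₇ k) ≡ (toℕ i + k) % 7
toℕ-+₇ i k = toℕ-fromℕ< _

+₇-assoc : ∀ i a b → (i +₇ a) +₇ b ≡ i +₇ (a + b)
+₇-assoc i a b = toℕ-injective (begin
  toℕ ((i +₇ a) +₇ b)       ≡⟨ toℕ-+₇ (i +₇ a) b ⟩
  (toℕ (i +₇ a) + b) % 7    ≡⟨ cong (λ x → (x + b) % 7) (toℕ-+₇ i a) ⟩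
  ((toℕ i + a) % 7 + b) % 7 ≡⟨ [m%n+k]%n≡[m+k]%n (toℕ i + a) b ⟩
  (toℕ i + a + b) % 7       ≡⟨ cong (_% 7) (+-assoc (toℕ i) a b) ⟩
  (toℕ i + (a + b)) % 7     ≡⟨ toℕ-+₇ i (a + b) ⟨
  toℕ (i +₇ (a + b))        ∎)

+₇-suc : ∀ i k → (i +₇ k) +₇ 1 ≡ i +₇ suc k
+₇-suc i k = trans (+₇-assoc i k 1) (cong (i +₇_) (+-comm k 1))

+₇-identityʳ : ∀ i → i +₇ 0 ≡ i
+₇-identityʳ i = toℕ-injective (begin
  toℕ (i +₇ 0)    ≡⟨ toℕ-+₇ i 0 ⟩
  (toℕ i + 0) % 7 ≡⟨ cong (_% 7) (+-identityʳ (toℕ i)) ⟩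
  toℕ i % 7       ≡⟨ m<n⇒m%n≡m (toℕ<n i) ⟩
  toℕ i           ∎)

+₇-cancelˡ : ∀ i a b → i +₇ a ≡ i +₇ b → a % 7 ≡ b % 7
+₇-cancelˡ i a b eq = +-cancelˡ-% (toℕ i) a b (<⇒≤ (toℕ<n i))
  (trans (sym (toℕ-+₇ i a)) (trans (cong toℕ eq) (toℕ-+₇ i b)))

-- Induced paths and walks

-- Consec of Defs, for paths of any length.
Consecutive : ∀ {m} → Fin m → Fin m → Set
Consecutive i j = suc (toℕ i) ≡ toℕ j ⊎ suc (toℕ j) ≡ toℕ i

consecutive? : ∀ {m} → Decidable (Consecutive {m})
consecutive? i j = (suc (toℕ i) ℕ.≟ toℕ j) ⊎-dec (suc (toℕ j) ℕ.≟ toℕ i)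

consecutive-suc⁺ : ∀ {m} {i j : Fin m} → Consecutive i j → Consecutive (suc i) (suc j)
consecutive-suc⁺ = Data.Sum.map (cong suc) (cong suc)

consecutive-suc⁻ : ∀ {m} {i j : Fin m} → Consecutive (suc i) (suc j) → Consecutive i j
consecutive-suc⁻ = Data.Sum.map suc-injective suc-injective

P₇-twinFree : ∀ (i j : Fin 7) →
  (∀ k → (Consecutive i k → Consecutive j k) × (Consecutive j k → Consecutive i k)) → i ≡ j
P₇-twinFree = toWitness {a? = all? λ i → all? λ j →
  all? (λ k → (consecutive? i k →-dec consecutive? j k) ×-dec (consecutive? j k →-dec consecutive? i k))
    →-dec (i Fin.≟ j)} tt

module _ (G : Graph) where
  open Graph G

  InducedPath : ∀ {m} → Vec (V G) m → Set
  InducedPath []           = ⊤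
  InducedPath (x ∷ [])     = ⊤
  InducedPath (x ∷ y ∷ zs) = E x y × All (λ z → ¬ E x z) zs × InducedPath (y ∷ zs)

  InducedPath-adjacency : ∀ {m} {xs : Vec (V G) m} → InducedPath xs → ∀ i j →
    (E (lookup xs i) (lookup xs j) → Consecutive i j) × (Consecutive i j → E (lookup xs i) (lookup xs j))
  InducedPath-adjacency {xs = x ∷ []}     _ zero zero = ⊥-elim ∘ E-irr , λ { (inj₁ ()) ; (inj₂ ()) }
  InducedPath-adjacency {xs = x ∷ y ∷ zs} _ zero zero = ⊥-elim ∘ E-irr , λ { (inj₁ ()) ; (inj₂ ()) }
  InducedPath-adjacency {xs = x ∷ y ∷ zs} (xy , _ , _) zero (suc zero) = (λ _ → inj₁ refl) , λ _ → xy
  InducedPath-adjacency {xs = x ∷ y ∷ zs} (xy , _ , _) (suc zero) zero = (λ _ → inj₂ refl) , λ _ → E-sym xy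
  InducedPath-adjacency {xs = x ∷ y ∷ zs} (_ , x≁zs , _) zero (suc (suc k)) =
    ⊥-elim ∘ lookup⁺ x≁zs k , λ { (inj₁ ()) ; (inj₂ ()) }
  InducedPath-adjacency {xs = x ∷ y ∷ zs} (_ , x≁zs , _) (suc (suc k)) zero =
    ⊥-elim ∘ lookup⁺ x≁zs k ∘ E-sym , λ { (inj₁ ()) ; (inj₂ ()) }
  InducedPath-adjacency {xs = x ∷ y ∷ zs} (_ , _ , path) (suc i) (suc j) =
    Product.map (consecutive-suc⁺ ∘_) (_∘ consecutive-suc⁻) (InducedPath-adjacency path i j)

  InducedPath⇒InducedP7 : (xs : Vec (V G) 7) → InducedPath xs → InducedP7 G (lookup xs)
  InducedPath⇒InducedP7 xs path = injective , adjacency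
    where
    adjacency = InducedPath-adjacency path
    injective : ∀ i j → lookup xs i ≡ lookup xs j → i ≡ j
    injective i j eq = P₇-twinFree i j λ k →
      (λ ik → proj₁ (adjacency j k) (subst (λ x → E x _) eq (proj₂ (adjacency i k) ik))) ,
      (λ jk → proj₁ (adjacency i k) (subst (λ x → E x _) (sym eq) (proj₂ (adjacency j k) jk)))

  P7Free⇒¬InducedPath : P7Free G → (xs : Vec (V G) 7) → ¬ InducedPath xs
  P7Free⇒¬InducedPath pf xs path = pf (lookup xs) (InducedPath⇒InducedP7 xs path)

  ReachIn-head : ∀ {P : V G → Set} {x y} → ReachIn G P x y → P x
  ReachIn-head (here px)     = px
  ReachIn-head (step px _ _) = px

  neighboursIn : {Q : V G → Set} → (∀ v → Dec (Q v)) → Subset n → Subset n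
  neighboursIn Q? X = subsetOf (λ v → Q? v ×-dec any? (λ x → x ∈? X ×-dec E-dec x v))

  module _ {Q : V G → Set} (Q? : ∀ v → Dec (Q v)) {X : Subset n} where

    ∈-neighboursIn⁺ : ∀ {x v} → Q v → x ∈ X → E x v → v ∈ neighboursIn Q? X
    ∈-neighboursIn⁺ Qv x∈X xv = ∈-subsetOf⁺ _ (Qv , _ , x∈X , xv)

    ∈-neighboursIn⁻ : ∀ {v} → v ∈ neighboursIn Q? X → Q v × ∃ λ x → x ∈ X × E x v
    ∈-neighboursIn⁻ = ∈-subsetOf⁻ _

  TwoStep : (V G → Set) → V G → V G → Set
  TwoStep Q x z = ∃ λ y → (Q x × Q y × Q z) × E x y × E y z

  TwoStepClosed : (V G → Set) → V G → Set
  TwoStepClosed Q v = ∀ {x z} → TwoStep Q x z → E v x → E v z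

  module _ {Q : V G → Set} where

    TwoStep-sym : ∀ {x z} → TwoStep Q x z → TwoStep Q z x
    TwoStep-sym (y , (Qx , Qy , Qz) , xy , yz) = y , (Qz , Qy , Qx) , E-sym yz , E-sym xy

    TwoStep-star-end : ∀ {x z} → Q x → Star (TwoStep Q) x z → Q z
    TwoStep-star-end Qx ε                             = Qx
    TwoStep-star-end _  ((_ , (_ , _ , Qz) , _) ◅ xs) = TwoStep-star-end Qz xs

    TwoStepClosed-star : ∀ {v x z} → TwoStepClosed Q v → Star (TwoStep Q) x z → E v x → E v z
    TwoStepClosed-star closed ε         vx = vx
    TwoStepClosed-star closed (xy ◅ ys) vx = TwoStepClosed-star closed ys (closed xy vx)

    TwoStep-star-shift : ∀ {a a′ b b′} → Q b → E b a → Q a → Star (TwoStep Q) a a′ →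
      E a′ b′ → Q b′ → Star (TwoStep Q) b b′
    TwoStep-star-shift Qb ba Qa ε a′b′ Qb′ = (_ , (Qb , Qa , Qb′) , ba , a′b′) ◅ ε
    TwoStep-star-shift Qb ba Qa ((y , (_ , Qy , Qz) , ay , yz) ◅ zs) a′b′ Qb′ =
      (_ , (Qb , Qa , Qy) , ba , ay) ◅ TwoStep-star-shift Qy yz Qz zs a′b′ Qb′

-- Vertices around the induced cycle

PShape : Fin 7 → Fin 7 → Set
PShape i j = j ≡ i ⊎ j ≡ i +₇ 3

SShape : Fin 7 → Fin 7 → Set
SShape i j = j ≡ i +₇ 5 ⊎ j ≡ i ⊎ j ≡ i +₇ 2

PShape? : ∀ i j → Dec (PShape i j)
PShape? i j = (j Fin.≟ i) ⊎-dec (j Fin.≟ i +₇ 3)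

SShape? : ∀ i j → Dec (SShape i j)
SShape? i j = (j Fin.≟ i +₇ 5) ⊎-dec (j Fin.≟ i) ⊎-dec (j Fin.≟ i +₇ 2)

Matches : (Fin 7 → Set) → (Fin 7 → Set) → Set
Matches M S = ∀ j → (M j → S j) × (S j → M j)

matches? : ∀ {M S} → (∀ j → Dec (M j)) → (∀ j → Dec (S j)) → Dec (Matches M S)
matches? M? S? = all? λ j → (M? j →-dec S? j) ×-dec (S? j →-dec M? j)

matches-cong : ∀ {M M′ S} → (∀ j → (M j → M′ j) × (M′ j → M j)) → Matches M S → Matches M′ S
matches-cong M⇔M′ M≈S j = proj₁ (M≈S j) ∘ proj₂ (M⇔M′ j) , proj₁ (M⇔M′ j) ∘ proj₂ (M≈S j)

TraceClassification : Subset 7 → Set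
TraceClassification N =
    (∃ λ i → i ∈ N × i +₇ 1 ∈ N)
  ⊎ (∃ λ i → i +₇ 1 ∈ N × i +₇ 2 ∉ N × i +₇ 3 ∉ N × i +₇ 4 ∉ N × i +₇ 5 ∉ N)
  ⊎ (∃ λ i → Matches (_∈ N) (PShape i))
  ⊎ (∃ λ i → Matches (_∈ N) (SShape i))
  ⊎ Empty N

classify-trace : ∀ N → TraceClassification N
classify-trace = toWitness {a? = all-subsets? λ N →
      any? (λ i → i ∈? N ×-dec i +₇ 1 ∈? N)
  ⊎-dec any? (λ i → i +₇ 1 ∈? N ×-dec ¬? (i +₇ 2 ∈? N) ×-dec ¬? (i +₇ 3 ∈? N)
                       ×-dec ¬? (i +₇ 4 ∈? N) ×-dec ¬? (i +₇ 5 ∈? N))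
  ⊎-dec any? (λ i → matches? (_∈? N) (PShape? i))
  ⊎-dec any? (λ i → matches? (_∈? N) (SShape? i))
  ⊎-dec ¬? (nonempty? N)} tt

module _ (G : Graph) (c : Fin 7 → V G) (C : InducedC7 G c) where
  open Graph G

  cycle-step : ∀ i → E (c i) (c (i +₇ 1))
  cycle-step i = proj₂ (proj₂ C i (i +₇ 1)) (inj₁ refl)

  cycle-edge : ∀ i k → E (c (i +₇ k)) (c (i +₇ suc k))
  cycle-edge i k = subst (E (c (i +₇ k)) ∘ c) (+₇-suc i k) (cycle-step (i +₇ k))

  -- The side conditions are closed for literal offsets, so they are found by evaluation.
  cycle-nonedge : ∀ i k l → {False (l % 7 ℕ.≟ suc k % 7)} → {False (k % 7 ℕ.≟ suc l % 7)} →
    ¬ E (c (i +₇ k)) (c (i +₇ l))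
  cycle-nonedge i k l {l≢k+1} {k≢l+1} e with proj₁ (proj₂ C _ _) e
  ... | inj₁ l≡k+1 = toWitnessFalse l≢k+1 (+₇-cancelˡ i l (suc k) (trans l≡k+1 (+₇-suc i k)))
  ... | inj₂ k≡l+1 = toWitnessFalse k≢l+1 (+₇-cancelˡ i k (suc l) (trans k≡l+1 (+₇-suc i l)))

  P-nonedge : ∀ {p k} → Matches (λ j → E p (c j)) (PShape k) →
    ∀ a → {False (a % 7 ℕ.≟ 0)} → {False (a % 7 ℕ.≟ 3)} → ¬ E p (c (k +₇ a))
  P-nonedge {k = k} p~C a {a≢0} {a≢3} e with proj₁ (p~C (k +₇ a)) e
  ... | inj₁ eq = toWitnessFalse a≢0 (+₇-cancelˡ k a 0 (trans eq (sym (+₇-identityʳ k))))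
  ... | inj₂ eq = toWitnessFalse a≢3 (+₇-cancelˡ k a 3 eq)

  S-nonedge : ∀ {s i} → Matches (λ j → E s (c j)) (SShape i) →
    ∀ a → {False (a % 7 ℕ.≟ 5)} → {False (a % 7 ℕ.≟ 0)} → {False (a % 7 ℕ.≟ 2)} → ¬ E s (c (i +₇ a))
  S-nonedge {i = i} s~C a {a≢5} {a≢0} {a≢2} e with proj₁ (s~C (i +₇ a)) e
  ... | inj₁ eq        = toWitnessFalse a≢5 (+₇-cancelˡ i a 5 eq)
  ... | inj₂ (inj₁ eq) = toWitnessFalse a≢0 (+₇-cancelˡ i a 0 (trans eq (sym (+₇-identityʳ i))))
  ... | inj₂ (inj₂ eq) = toWitnessFalse a≢2 (+₇-cancelˡ i a 2 eq)

  A-neighbour-off-cycle : ∀ {z t} → InA G c z → E z t → OffC G c t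
  A-neighbour-off-cycle (_ , z≁C) zt j t≡cj = z≁C j (subst (E _) t≡cj zt)

  trace : V G → Subset 7
  trace w = subsetOf (λ j → E-dec w (c j))

  ∈-trace⁺ : ∀ {w j} → E w (c j) → j ∈ trace w
  ∈-trace⁺ {w} = ∈-subsetOf⁺ (λ j → E-dec w (c j))

  ∈-trace⁻ : ∀ {w j} → j ∈ trace w → E w (c j)
  ∈-trace⁻ {w} = ∈-subsetOf⁻ (λ j → E-dec w (c j))

  OffC? : ∀ v → Dec (OffC G c v)
  OffC? v = all? λ j → ¬? (v Fin.≟ c j)

  InA? : ∀ v → Dec (InA G c v)
  InA? v = OffC? v ×-dec all? (λ j → ¬? (E-dec v (c j)))

  InP? : ∀ v → Dec (InP G c v)
  InP? v = OffC? v ×-dec any? (λ i → matches? (λ j → E-dec v (c j)) (PShape? i))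

  InS? : ∀ v → Dec (InS G c v)
  InS? v = OffC? v ×-dec any? (λ i → matches? (λ j → E-dec v (c j)) (SShape? i))

  InX? : ∀ v → Dec (InX G c v)
  InX? v = InA? v ×-dec any? (λ p → InP? p ×-dec E-dec v p)

  InY? : ∀ v → Dec (InY G c v)
  InY? v = InA? v ×-dec ¬? (InX? v) ×-dec any? (λ s → InS? s ×-dec E-dec v s)

  module _ (pf : P7Free G) where

    long-gap-impossible : ∀ {z w} i → InA G c z → E z w → E w (c (i +₇ 1)) →
      ¬ E w (c (i +₇ 2)) → ¬ E w (c (i +₇ 3)) → ¬ E w (c (i +₇ 4)) → ¬ E w (c (i +₇ 5)) → ⊥
    long-gap-impossible {z} {w} i (_ , z≁C) zw w~1 w≁2 w≁3 w≁4 w≁5 = P7Free⇒¬InducedPath G pf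
      (z ∷ w ∷ c (i +₇ 1) ∷ c (i +₇ 2) ∷ c (i +₇ 3) ∷ c (i +₇ 4) ∷ c (i +₇ 5) ∷ [])
      ( zw             , z≁C _ ∷ z≁C _ ∷ z≁C _ ∷ z≁C _ ∷ z≁C _ ∷ []
      , w~1            , w≁2 ∷ w≁3 ∷ w≁4 ∷ w≁5 ∷ []
      , cycle-edge i 1 , cycle-nonedge i 1 3 ∷ cycle-nonedge i 1 4 ∷ cycle-nonedge i 1 5 ∷ []
      , cycle-edge i 2 , cycle-nonedge i 2 4 ∷ cycle-nonedge i 2 5 ∷ []
      , cycle-edge i 3 , cycle-nonedge i 3 5 ∷ []
      , cycle-edge i 4 , [] , tt)

    A-path₃-to-S-impossible : ∀ {a₀ a₁ a₂ s i} → InA G c a₀ → InA G c a₁ → InA G c a₂ →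
      InducedPath G (a₀ ∷ a₁ ∷ a₂ ∷ s ∷ []) → Matches (λ j → E s (c j)) (SShape i) → ⊥
    A-path₃-to-S-impossible {a₀} {a₁} {a₂} {s} {i} (_ , a₀≁C) (_ , a₁≁C) (_ , a₂≁C)
      (a₀a₁ , a₀≁a₂ ∷ a₀≁s ∷ [] , a₁a₂ , a₁≁s ∷ [] , a₂s , [] , _) s~C =
      P7Free⇒¬InducedPath G pf (a₀ ∷ a₁ ∷ a₂ ∷ s ∷ c (i +₇ 2) ∷ c (i +₇ 3) ∷ c (i +₇ 4) ∷ [])
        ( a₀a₁                             , a₀≁a₂ ∷ a₀≁s ∷ a₀≁C _ ∷ a₀≁C _ ∷ a₀≁C _ ∷ []
        , a₁a₂                             , a₁≁s ∷ a₁≁C _ ∷ a₁≁C _ ∷ a₁≁C _ ∷ []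
        , a₂s                              , a₂≁C _ ∷ a₂≁C _ ∷ a₂≁C _ ∷ []
        , proj₂ (s~C _) (inj₂ (inj₂ refl)) , S-nonedge s~C 3 ∷ S-nonedge s~C 4 ∷ []
        , cycle-edge i 2                   , cycle-nonedge i 2 4 ∷ []
        , cycle-edge i 3                   , [] , tt)

    A-path₄-to-P-impossible : ∀ {a₀ a₁ a₂ a₃ p k} → InA G c a₀ → InA G c a₁ → InA G c a₂ → InA G c a₃ →
      InducedPath G (a₀ ∷ a₁ ∷ a₂ ∷ a₃ ∷ p ∷ []) → Matches (λ j → E p (c j)) (PShape k) → ⊥
    A-path₄-to-P-impossible {a₀} {a₁} {a₂} {a₃} {p} {k} (_ , a₀≁C) (_ , a₁≁C) (_ , a₂≁C) (_ , a₃≁C)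
      (a₀a₁ , a₀≁a₂ ∷ a₀≁a₃ ∷ a₀≁p ∷ [] , a₁a₂ , a₁≁a₃ ∷ a₁≁p ∷ [] , a₂a₃ , a₂≁p ∷ [] , a₃p , [] , _) p~C =
      P7Free⇒¬InducedPath G pf (a₀ ∷ a₁ ∷ a₂ ∷ a₃ ∷ p ∷ c (k +₇ 3) ∷ c (k +₇ 4) ∷ [])
        ( a₀a₁                       , a₀≁a₂ ∷ a₀≁a₃ ∷ a₀≁p ∷ a₀≁C _ ∷ a₀≁C _ ∷ []
        , a₁a₂                       , a₁≁a₃ ∷ a₁≁p ∷ a₁≁C _ ∷ a₁≁C _ ∷ []
        , a₂a₃                       , a₂≁p ∷ a₂≁C _ ∷ a₂≁C _ ∷ []
        , a₃p                        , a₃≁C _ ∷ a₃≁C _ ∷ []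
        , proj₂ (p~C _) (inj₂ refl)  , P-nonedge p~C 4 ∷ []
        , cycle-edge k 3             , [] , tt)

    A-path₂-to-P-impossible : ∀ {a₀ a₁ p k} → InA G c a₀ → InA G c a₁ →
      InducedPath G (a₀ ∷ a₁ ∷ p ∷ []) → Matches (λ j → E p (c j)) (PShape k) → ⊥
    A-path₂-to-P-impossible {a₀} {a₁} {p} {k} (_ , a₀≁C) (_ , a₁≁C) (a₀a₁ , a₀≁p ∷ [] , a₁p , [] , _) p~C =
      P7Free⇒¬InducedPath G pf (a₀ ∷ a₁ ∷ p ∷ c (k +₇ 3) ∷ c (k +₇ 4) ∷ c (k +₇ 5) ∷ c (k +₇ 6) ∷ [])
        ( a₀a₁                      , a₀≁p ∷ a₀≁C _ ∷ a₀≁C _ ∷ a₀≁C _ ∷ a₀≁C _ ∷ []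
        , a₁p                       , a₁≁C _ ∷ a₁≁C _ ∷ a₁≁C _ ∷ a₁≁C _ ∷ []
        , proj₂ (p~C _) (inj₂ refl) , P-nonedge p~C 4 ∷ P-nonedge p~C 5 ∷ P-nonedge p~C 6 ∷ []
        , cycle-edge k 3            , cycle-nonedge k 3 5 ∷ cycle-nonedge k 3 6 ∷ []
        , cycle-edge k 4            , cycle-nonedge k 4 6 ∷ []
        , cycle-edge k 5            , [] , tt)

    module _ (tf : TriangleFree G) where

      A-neighbour-trichotomy : ∀ {z t} → InA G c z → E z t → InP G c t ⊎ InS G c t ⊎ InA G c t
      A-neighbour-trichotomy {z} {t} Az zt = classify (classify-trace (trace t))
        where
        t-off = A-neighbour-off-cycle Az zt
        edge = ∈-trace⁻
        nonedge : ∀ {j} → j ∉ trace t → ¬ E t (c j)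
        nonedge j∉ = j∉ ∘ ∈-trace⁺
        trace⇔edges : ∀ j → (j ∈ trace t → E t (c j)) × (E t (c j) → j ∈ trace t)
        trace⇔edges j = ∈-trace⁻ , ∈-trace⁺
        classify : TraceClassification (trace t) → InP G c t ⊎ InS G c t ⊎ InA G c t
        classify (inj₁ (i , i∈ , i+1∈)) = ⊥-elim (tf t (c i) (c (i +₇ 1)) (edge i∈) (cycle-step i) (edge i+1∈))
        classify (inj₂ (inj₁ (i , i+1∈ , i+2∉ , i+3∉ , i+4∉ , i+5∉))) = ⊥-elim
          (long-gap-impossible i Az zt (edge i+1∈) (nonedge i+2∉) (nonedge i+3∉) (nonedge i+4∉) (nonedge i+5∉))
        classify (inj₂ (inj₂ (inj₁ (i , ≈P))))         = inj₁ (t-off , i , matches-cong trace⇔edges ≈P)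
        classify (inj₂ (inj₂ (inj₂ (inj₁ (i , ≈S)))))  = inj₂ (inj₁ (t-off , i , matches-cong trace⇔edges ≈S))
        classify (inj₂ (inj₂ (inj₂ (inj₂ empty))))     = inj₂ (inj₂ (t-off , λ j → empty ∘ (j ,_) ∘ ∈-trace⁺))

      module _ (cl : Clean G) where

        Z-Y-nonadjacent : ∀ {z y} → InZ G c z → E z y → ¬ InY G c y
        Z-Y-nonadjacent {z} {y} (Az , z∉X , z∉Y) zy (Ay , _ , s , Ss@(_ , _ , s~C) , ys) =
          proj₁ cl z s (z≢s , z≁s , N[z]⊆N[s])
          where
          z≁s : ¬ E z s
          z≁s zs = z∉Y (Az , z∉X , s , Ss , zs)
          z≢s : z ≢ s
          z≢s refl = proj₂ Az _ (proj₂ (s~C _) (inj₂ (inj₁ refl)))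
          N[z]⊆N[s] : ∀ t → E z t → E s t
          N[z]⊆N[s] t zt = decidable-stable (E-dec s t) λ s≁t → t-cases s≁t (A-neighbour-trichotomy Az zt)
            where
            t-cases : ¬ E s t → InP G c t ⊎ InS G c t ⊎ InA G c t → ⊥
            t-cases _   (inj₁ Pt)        = z∉X (Az , t , Pt , zt)
            t-cases _   (inj₂ (inj₁ St)) = z∉Y (Az , z∉X , t , St , zt)
            t-cases s≁t (inj₂ (inj₂ At)) = A-path₃-to-S-impossible At Az Ay
              (E-sym zt , (λ ty → tf t z y (E-sym zt) zy ty) ∷ s≁t ∘ E-sym ∷ [] , zy , z≁s ∷ [] , ys , [] , tt) s~C

        Z-closed : ∀ {z t} → InZ G c z → E z t → InZ G c t
        Z-closed {z} {t} Zz@(Az , z∉X , z∉Y) zt = t-cases (A-neighbour-trichotomy Az zt)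
          where
          t∉X : InA G c t → ¬ InX G c t
          t∉X At (_ , p , Pp@(_ , _ , p~C) , tp) =
            A-path₂-to-P-impossible Az At (zt , (λ zp → z∉X (Az , p , Pp , zp)) ∷ [] , tp , [] , tt) p~C
          t-cases : InP G c t ⊎ InS G c t ⊎ InA G c t → InZ G c t
          t-cases (inj₁ Pt)        = ⊥-elim (z∉X (Az , t , Pt , zt))
          t-cases (inj₂ (inj₁ St)) = ⊥-elim (z∉Y (Az , z∉X , t , St , zt))
          t-cases (inj₂ (inj₂ At)) = At , t∉X At , Z-Y-nonadjacent Zz zt

        module _ (co : Connected G) where

          Z-empty : ∀ z → ¬ InZ G c z
          Z-empty z = walk (co z (c zero))
            where
            walk : ∀ {x} → ReachIn G (λ _ → ⊤) x (c zero) → ¬ InZ G c x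
            walk (here _)         ((x-off , _) , _) = x-off zero refl
            walk (step _ xt rest) Zx                = walk rest (Z-closed Zx xt)

          nonY⇒TwoStepClosed : ∀ {v} → ¬ InY G c v → TwoStepClosed G (InY G c) v
          nonY⇒TwoStepClosed {v} v∉Y {y₁} {y₃}
            (y₂ , ((A₁ , y₁∉X , _) , (A₂ , y₂∉X , _) , (A₃ , y₃∉X , _)) , y₁y₂ , y₂y₃) vy₁ =
            decidable-stable (E-dec v y₃) λ v≁y₃ → v-cases v≁y₃ (A-neighbour-trichotomy A₁ (E-sym vy₁))
            where
            y₃≁y₁ : ¬ E y₃ y₁
            y₃≁y₁ y₃y₁ = tf y₁ y₂ y₃ y₁y₂ y₂y₃ (E-sym y₃y₁)
            y₂≁v : ¬ E y₂ v
            y₂≁v y₂v = tf y₂ y₁ v (E-sym y₁y₂) (E-sym vy₁) y₂v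
            v-cases : ¬ E v y₃ → InP G c v ⊎ InS G c v ⊎ InA G c v → ⊥
            v-cases _    (inj₁ Pv)                   = y₁∉X (A₁ , v , Pv , E-sym vy₁)
            v-cases v≁y₃ (inj₂ (inj₁ (_ , _ , v~C))) = A-path₃-to-S-impossible A₃ A₂ A₁
              (E-sym y₂y₃ , y₃≁y₁ ∷ v≁y₃ ∘ E-sym ∷ [] , E-sym y₁y₂ , y₂≁v ∷ [] , E-sym vy₁ , [] , tt) v~C
            v-cases v≁y₃ (inj₂ (inj₂ Av))            = Z-empty v (Av , v∉X , v∉Y)
              where
              v∉X : ¬ InX G c v
              v∉X (_ , p , Pp@(_ , _ , p~C) , vp) = A-path₄-to-P-impossible A₃ A₂ A₁ Av
                ( E-sym y₂y₃ , y₃≁y₁ ∷ v≁y₃ ∘ E-sym ∷ (λ y₃p → y₃∉X (A₃ , p , Pp , y₃p)) ∷ []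
                , E-sym y₁y₂ , y₂≁v ∷ (λ y₂p → y₂∉X (A₂ , p , Pp , y₂p)) ∷ []
                , E-sym vy₁  , (λ y₁p → y₁∉X (A₁ , p , Pp , y₁p)) ∷ []
                , vp         , [] , tt) p~C

          -- A is the closure of {u} under two steps inside Y, computed as a fixpoint so that it is a Subset.
          module Component {u} (u∈Y : InY G c u) where
            private
              Y : V G → Set
              Y = InY G c
              N : Subset n → Subset n
              N = neighboursIn G InY?

            EvenReachable : Subset n → Set
            EvenReachable X = u ∈ X × (∀ {a} → a ∈ X → Star (TwoStep G Y) u a)

            closure : ∃ λ X → X ∪ N (N X) ≡ X × EvenReachable X
            closure = fixpoint (λ X → X ∪ N (N X)) (λ X → p⊆p∪q (N (N X))) EvenReachable preserved
                        ⁅ u ⁆ (x∈⁅x⁆ u , λ a∈ → subst (Star _ u) (sym (x∈⁅y⁆⇒x≡y u a∈)) ε)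
              where
              preserved : ∀ X → EvenReachable X → EvenReachable (X ∪ N (N X))
              preserved X (u∈X , walk) = p⊆p∪q (N (N X)) u∈X , [ walk , extend ]′ ∘ x∈p∪q⁻ X (N (N X))
                where
                extend : ∀ {a} → a ∈ N (N X) → Star (TwoStep G Y) u a
                extend a∈NNX =
                  let (Ya , b , b∈NX , ba) = ∈-neighboursIn⁻ G InY? a∈NNX
                      (Yb , x , x∈X , xb)  = ∈-neighboursIn⁻ G InY? b∈NX
                  in walk x∈X ◅◅ ((b , (TwoStep-star-end G u∈Y (walk x∈X) , Yb , Ya) , xb , ba) ◅ ε)

            A B : Subset n
            A = proj₁ closure
            B = N A

            u∈A : u ∈ A
            u∈A = proj₁ (proj₂ (proj₂ closure))

            walk : ∀ {a} → a ∈ A → Star (TwoStep G Y) u a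
            walk = proj₂ (proj₂ (proj₂ closure))

            NB⊆A : ∀ {a} → a ∈ N B → a ∈ A
            NB⊆A a∈ = subst (_ ∈_) (proj₁ (proj₂ closure)) (q⊆p∪q A (N B) a∈)

            A⊆Y : ∀ {a} → a ∈ A → Y a
            A⊆Y = TwoStep-star-end G u∈Y ∘ walk

            B⊆Y : ∀ {b} → b ∈ B → Y b
            B⊆Y = proj₁ ∘ ∈-neighboursIn⁻ G InY?

            A∩B-empty : ∀ {a} → a ∈ A → a ∉ B
            A∩B-empty {a} a∈A a∈B =
              let (_ , a′ , a′∈A , a′a) = ∈-neighboursIn⁻ G InY? a∈B
              in tf s a′ a (s~A a′∈A) a′a (s~A a∈A)
              where
              s = proj₁ (proj₂ (proj₂ u∈Y))
              s∉Y : ¬ Y s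
              s∉Y ((_ , s≁C) , _) = let (_ , _ , s~C) = proj₁ (proj₂ (proj₂ (proj₂ u∈Y))) in s≁C _ (proj₂ (s~C _) (inj₂ (inj₁ refl)))
              s~A : ∀ {a} → a ∈ A → E s a
              s~A a∈ = TwoStepClosed-star G (nonY⇒TwoStepClosed s∉Y) (walk a∈) (E-sym (proj₂ (proj₂ (proj₂ (proj₂ u∈Y)))))

            A-stable : Stable G A
            A-stable a a′ a∈ a′∈ aa′ = A∩B-empty a′∈ (∈-neighboursIn⁺ G InY? (A⊆Y a′∈) a∈ aa′)

            B-stable : Stable G B
            B-stable b b′ b∈ b′∈ bb′ = A∩B-empty (NB⊆A (∈-neighboursIn⁺ G InY? (B⊆Y b′∈) b∈ bb′)) b′∈

            homogeneous : ∀ x → x ∉ A → x ∉ B → NotMixedOn G A x × NotMixedOn G B x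
            homogeneous x x∉A x∉B = on-A , on-B
              where
              A-walk : ∀ {a a′} → a ∈ A → a′ ∈ A → Star (TwoStep G Y) a a′
              A-walk a∈ a′∈ = reverse (TwoStep-sym G) (walk a∈) ◅◅ walk a′∈
              on-A : NotMixedOn G A x
              on-A ((a₁ , a₁∈ , xa₁) , (a₂ , a₂∈ , x≁a₂)) = x≁a₂ (TwoStepClosed-star G closed (A-walk a₁∈ a₂∈) xa₁)
                where closed = nonY⇒TwoStepClosed λ Yx → x∉B (∈-neighboursIn⁺ G InY? Yx a₁∈ (E-sym xa₁))
              on-B : NotMixedOn G B x
              on-B ((b₁ , b₁∈ , xb₁) , (b₂ , b₂∈ , x≁b₂)) =
                let (_ , a₁ , a₁∈ , a₁b₁) = ∈-neighboursIn⁻ G InY? b₁∈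
                    (_ , a₂ , a₂∈ , a₂b₂) = ∈-neighboursIn⁻ G InY? b₂∈
                in x≁b₂ (TwoStepClosed-star G closed
                     (TwoStep-star-shift G (B⊆Y b₁∈) (E-sym a₁b₁) (A⊆Y a₁∈) (A-walk a₁∈ a₂∈) a₂b₂ (B⊆Y b₂∈)) xb₁)
                where closed = nonY⇒TwoStepClosed λ Yx → x∉A (NB⊆A (∈-neighboursIn⁺ G InY? Yx b₁∈ (E-sym xb₁)))

            reachable⊆A∪B : ∀ {x y} → ReachIn G Y x y → x ∈ A ⊎ x ∈ B → y ∈ A ⊎ y ∈ B
            reachable⊆A∪B (here _)         x∈        = x∈
            reachable⊆A∪B (step _ xy rest) (inj₁ x∈A) =
              reachable⊆A∪B rest (inj₂ (∈-neighboursIn⁺ G InY? (ReachIn-head G rest) x∈A xy))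
            reachable⊆A∪B (step _ xy rest) (inj₂ x∈B) =
              reachable⊆A∪B rest (inj₁ (NB⊆A (∈-neighboursIn⁺ G InY? (ReachIn-head G rest) x∈B xy)))

            B-nonempty : ∀ {v} → ReachIn G Y u v → v ≢ u → ∃ (_∈ B)
            B-nonempty (here _)         v≢u = ⊥-elim (v≢u refl)
            B-nonempty (step _ uy rest) _   = _ , ∈-neighboursIn⁺ G InY? (ReachIn-head G rest) u∈A uy

            at-most-two : ∀ {v w} → ReachIn G Y u v → ReachIn G Y u w → v ≢ u → w ≢ u → w ≢ v → ⊥
            at-most-two rv rw v≢u w≢u w≢v = proj₂ cl A B
              ( (λ _ → A∩B-empty) , (u , u∈A) , B-nonempty rv v≢u , A-stable , B-stable
              , subst (2 <_) ∣A∪B∣ (three-elements⇒2<∣p∣ (in-A∪B (here u∈Y)) (in-A∪B rv) (in-A∪B rw) v≢u w≢u w≢v)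
              , subst (_< n) ∣A∪B∣ (x∉p⇒∣p∣<n c₀∉A∪B)
              , homogeneous)
              where
              ∣A∪B∣ = disjoint⇒∣p∪q∣≡∣p∣+∣q∣ A B A∩B-empty
              in-A∪B : ∀ {x} → ReachIn G Y u x → x ∈ A ∪ B
              in-A∪B r = x∈p∪q⁺ (reachable⊆A∪B r (inj₁ u∈A))
              c₀∉A∪B : c zero ∉ A ∪ B
              c₀∉A∪B = [ c₀∉Y ∘ A⊆Y , c₀∉Y ∘ B⊆Y ]′ ∘ x∈p∪q⁻ A B
                where
                c₀∉Y : ¬ Y (c zero)
                c₀∉Y ((c₀-off , _) , _) = c₀-off zero refl

          Y-components-small : ∀ u v w → ReachIn G (InY G c) u v → ReachIn G (InY G c) u w →
            v ≡ u ⊎ w ≡ u ⊎ v ≡ w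
          Y-components-small u v w rv rw with v Fin.≟ u | w Fin.≟ u | w Fin.≟ v
          ... | yes v≡u | _       | _       = inj₁ v≡u
          ... | no _    | yes w≡u | _       = inj₂ (inj₁ w≡u)
          ... | no _    | no _    | yes w≡v = inj₂ (inj₂ (sym w≡v))
          ... | no v≢u  | no w≢u  | no w≢v  =
            ⊥-elim (Component.at-most-two (ReachIn-head G rv) rv rw v≢u w≢u w≢v)

mainTheorem15 : (G : Graph) → Clean G → Connected G → P7Free G → TriangleFree G →
    (c : Fin 7 → V G) → InducedC7 G c →
      ((∀ v → ¬ InZ G c v)
      × (∀ u v w → ReachIn G (InY G c) u v → ReachIn G (InY G c) u w →
           (v ≡ u ⊎ w ≡ u ⊎ v ≡ w)))
mainTheorem15 G cl co pf tf c C = Z-empty G c C pf tf cl co , Y-components-small G c C pf tf cl co
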